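{- Let $G$ be a compressed graph with $n$ vertices and let $I$ be an independent set in $G$ of size at least $45 n^{1/3}\log_2 n$. Then $I$ contains a set of clones of size at least $|I|/5$.
   Context: A set $U$ of vertices of $G$ is a set of clones if any two vertices in $U$ have the same neighbourhood in $G$ (in particular $U$ is independent). A vertex is triangular if every edge incident with it lies in a triangle (in particular isolated vertices are triangular). A graph $G$ on $n$ vertices is compressed if (i) every independent set in $G$ is a union of at most $3\log_2 n$ sets of clones, each of which, with at most four exceptions, has size at most $3n^{1/3}$; and (ii) the set $U$ of triangular vertices induces a clique in $G$, and all vertices of $U$ have the same neighbourhood outside $U$. -}

module Defs where

open import Data.Nat using (ℕ; suc; _+_; _*_; _^_; _≤_; _<_)
open import Data.Fin using (Fin)
open import Data.Fin.Subset using (Subset; _∈_; _∉_; ∣_∣)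
open import Data.Product using (Σ; ∃; _×_)
open import Relation.Nullary using (¬_; Dec)
open import Relation.Binary.PropositionalEquality using (_≡_; _≢_)
open import Function.Bundles using (_⇔_)

record Graph (n : ℕ) : Set₁ where
  field
    Adj    : Fin n → Fin n → Set
    adj?   : ∀ u v → Dec (Adj u v)
    sym    : ∀ {u v} → Adj u v → Adj v u
    irrefl : ∀ {u} → ¬ Adj u u

module _ {n : ℕ} (G : Graph n) where
  open Graph G

  Independent : Subset n → Set
  Independent U = ∀ u v → u ∈ U → v ∈ U → ¬ Adj u v

  Clones : Subset n → Set
  Clones U = ∀ u v → u ∈ U → v ∈ U → ∀ w → (Adj u w ⇔ Adj v w)

  Triangular : Fin n → Set
  Triangular v = ∀ w → Adj v w → ∃ λ x → Adj v x × Adj w x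

  -- k ≤ 3 log₂ n   (exactly equivalent, for natural k, to 2^k ≤ n^3)
  -- s ≤ 3 n^{1/3}  (exactly equivalent, for natural s, to s^3 ≤ 27 n)
  Compressed : Set
  Compressed =
    (∀ (I : Subset n) → Independent I →
       Σ ℕ λ k → (2 ^ k ≤ n ^ 3) ×
       Σ (Fin k → Subset n) λ Us →
         (∀ i → Clones (Us i)) ×
         (∀ v → (v ∈ I ⇔ ∃ λ i → v ∈ Us i)) ×
         Σ (Subset k) λ E → (∣ E ∣ ≤ 4) ×
           (∀ i → i ∉ E → ∣ Us i ∣ ^ 3 ≤ 27 * n))
    ×
    (∀ u v → Triangular u → Triangular v → u ≢ v → Adj u v)
    ×
    (∀ u v w → Triangular u → Triangular v → ¬ Triangular w → (Adj u w ⇔ Adj v w))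

-- m ≥ 45 n^{1/3} log₂ n, expressed exactly in ℕ:
-- for every rational p/q (q ≥ 1, p ≥ 0) with p/q < log₂ n (i.e. 2^p < n^q),
-- p/q ≤ m / (45 n^{1/3}), i.e. 45^3 · n · p^3 ≤ m^3 · q^3.
-- Since such p/q are dense below log₂ n, this is equivalent to log₂ n ≤ m/(45 n^{1/3}).
AtLeast45CubeRootLog : ℕ → ℕ → Set
AtLeast45CubeRootLog n m =
  ∀ p q → 1 ≤ q → 2 ^ p < n ^ q → (45 ^ 3) * n * p ^ 3 ≤ m ^ 3 * q ^ 3

-- Every independent set I is covered by k ≤ 3 log₂ n clone classes, all but four
-- of size at most 3 n^{1/3}.  The size assumption on I gives 3 n^{1/3} ≤ |I|/(5k),
-- so if every class had fewer than |I|/5 elements, the four exceptional classes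
-- would hold fewer than 4|I|/5 vertices and the remaining ones at most
-- k · |I|/(5k) = |I|/5, fewer than |I| in total.  The only analytic step is
-- turning the rational lower bounds on log₂ n into (15k)³ n ≤ |I|³: the
-- approximants (kR − 1)/(3R) of k/3 ≤ log₂ n tend to k/3.
module Submission where

open import Defs
open import Data.Empty using (⊥-elim)
open import Data.Fin using (zero; suc)
open import Data.Fin.Properties using (any?)
open import Data.Fin.Subset using (Subset; _∈_; _∉_; _⊆_; ∣_∣; _∪_; ⊥; inside; outside)
open import Data.Fin.Subset.Properties using (x∈p∪q⁺; ∉⊥; p⊆q⇒∣p∣≤∣q∣; ∣⊥∣≡0)
open import Data.Nat using (ℕ; zero; suc; pred; _+_; _*_; _^_; _≤_; _<_; _≤?_; z≤n; s≤s; NonZero)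
open import Data.Nat.Properties
open import Algebra.Properties.Semiring.Sum +-*-semiring using (sum; *-distribˡ-sum)
open import Data.Nat.Solver using (module +-*-Solver)
open import Data.Product using (Σ; ∃; _×_; _,_)
open import Data.Sum using (inj₁; inj₂)
open import Data.Vec using ([]; _∷_; here; there)
open import Data.Vec.Functional using (Vector; foldr; map; tail)
open import Function.Bundles using (_⇔_; Equivalence)
open import Relation.Binary.PropositionalEquality using (_≡_; refl; sym; cong; subst; subst₂)
open import Relation.Nullary using (yes; no)

open +-*-Solver using (solve; _:=_; _:+_; _:*_; _:^_; con)

∣p∪q∣≤∣p∣+∣q∣ : ∀ {n} (p q : Subset n) → ∣ p ∪ q ∣ ≤ ∣ p ∣ + ∣ q ∣
∣p∪q∣≤∣p∣+∣q∣ []            []            = z≤n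
∣p∪q∣≤∣p∣+∣q∣ (inside  ∷ p) (inside  ∷ q) =
  s≤s (≤-trans (∣p∪q∣≤∣p∣+∣q∣ p q) (+-monoʳ-≤ ∣ p ∣ (n≤1+n ∣ q ∣)))
∣p∪q∣≤∣p∣+∣q∣ (inside  ∷ p) (outside ∷ q) = s≤s (∣p∪q∣≤∣p∣+∣q∣ p q)
∣p∪q∣≤∣p∣+∣q∣ (outside ∷ p) (inside  ∷ q) =
  subst (suc ∣ p ∪ q ∣ ≤_) (sym (+-suc ∣ p ∣ ∣ q ∣)) (s≤s (∣p∪q∣≤∣p∣+∣q∣ p q))
∣p∪q∣≤∣p∣+∣q∣ (outside ∷ p) (outside ∷ q) = ∣p∪q∣≤∣p∣+∣q∣ p q

⋃ᵥ : ∀ {n k} → Vector (Subset n) k → Subset n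
⋃ᵥ = foldr _∪_ ⊥

⊆⋃ᵥ : ∀ {n k} (Us : Vector (Subset n) k) i → Us i ⊆ ⋃ᵥ Us
⊆⋃ᵥ Us zero    v∈Uᵢ = x∈p∪q⁺ (inj₁ v∈Uᵢ)
⊆⋃ᵥ Us (suc i) v∈Uᵢ = x∈p∪q⁺ {p = Us zero} (inj₂ (⊆⋃ᵥ (tail Us) i v∈Uᵢ))

∣⋃ᵥ∣≤sum : ∀ {n k} (Us : Vector (Subset n) k) → ∣ ⋃ᵥ Us ∣ ≤ sum (map ∣_∣ Us)
∣⋃ᵥ∣≤sum {n} {zero}  Us = ≤-reflexive (∣⊥∣≡0 n)
∣⋃ᵥ∣≤sum {k = suc _} Us = ≤-trans (∣p∪q∣≤∣p∣+∣q∣ (Us zero) (⋃ᵥ (tail Us)))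
                                  (+-monoʳ-≤ ∣ Us zero ∣ (∣⋃ᵥ∣≤sum (tail Us)))

sum-≤-split : ∀ {k} (E : Subset k) (a : Vector ℕ k) {x y} →
  (∀ i → i ∈ E → a i ≤ x) → (∀ i → i ∉ E → a i ≤ y) → sum a ≤ ∣ E ∣ * x + k * y
sum-≤-split         []      a _ _ = z≤n
sum-≤-split {suc k} (b ∷ E) a {x} {y} inE outE = head-step b (inE zero) (outE zero)
  where
  open ≤-Reasoning
  ih : sum (tail a) ≤ ∣ E ∣ * x + k * y
  ih = sum-≤-split E (tail a) (λ i i∈E → inE (suc i) (there i∈E))
                              (λ i i∉E → outE (suc i) (λ { (there i∈E) → i∉E i∈E }))
  head-step : ∀ b → (zero ∈ b ∷ E → a zero ≤ x) → (zero ∉ b ∷ E → a zero ≤ y) →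
              a zero + sum (tail a) ≤ ∣ b ∷ E ∣ * x + suc k * y
  head-step inside  a₀≤x _ = begin
    a zero + sum (tail a)             ≤⟨ +-mono-≤ (a₀≤x here) ih ⟩
    x + (∣ E ∣ * x + k * y)           ≡⟨ sym (+-assoc x (∣ E ∣ * x) (k * y)) ⟩
    (x + ∣ E ∣ * x) + k * y           ≤⟨ +-monoʳ-≤ (x + ∣ E ∣ * x) (m≤n+m (k * y) y) ⟩
    (x + ∣ E ∣ * x) + (y + k * y)     ∎
  head-step outside _ a₀≤y = begin
    a zero + sum (tail a)             ≤⟨ +-mono-≤ (a₀≤y λ ()) ih ⟩
    y + (∣ E ∣ * x + k * y)           ≡⟨ solve 3 (λ y ex ky → y :+ (ex :+ ky) := ex :+ (y :+ ky))
                                                refl y (∣ E ∣ * x) (k * y) ⟩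
    ∣ E ∣ * x + (y + k * y)           ∎

fifth-in-some-part : ∀ {k} (c : Vector ℕ k) (E : Subset k) {m} → 0 < m → m ≤ sum c → ∣ E ∣ ≤ 4 →
  (∀ i → i ∉ E → 5 * k * c i ≤ m) → ∃ λ i → m ≤ 5 * c i
fifth-in-some-part {zero}  c E 0<m m≤0 _ _ = ⊥-elim (<⇒≱ 0<m m≤0)
fifth-in-some-part {suc k} c E {suc m} _ m≤Σc ∣E∣≤4 small with any? (λ i → suc m ≤? 5 * c i)
... | yes large = large
... | no ¬large = ⊥-elim (<-irrefl refl (begin-strict
  5 * m + 1     <⟨ +-monoʳ-< (5 * m) (s≤s (s≤s z≤n)) ⟩
  5 * m + 5     ≡⟨ solve 1 (λ m → con 5 :* m :+ con 5 := con 5 :* (con 1 :+ m)) refl m ⟩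
  5 * suc m     ≤⟨ *-monoʳ-≤ 5 m≤Σc ⟩
  5 * sum c     ≤⟨ *-cancelˡ-≤ (suc k) K*5Σc≤K*[5m+1] ⟩
  5 * m + 1     ∎))
  where
  open ≤-Reasoning
  K = suc k
  5c≤m : ∀ i → 5 * c i ≤ m
  5c≤m i = ≤-pred (≰⇒> (λ m<5c → ¬large (i , m<5c)))
  K*5Σc≤K*[5m+1] : K * (5 * sum c) ≤ K * (5 * m + 1)
  K*5Σc≤K*[5m+1] = begin
    K * (5 * sum c)                   ≡⟨ solve 2 (λ K s → K :* (con 5 :* s) := con 5 :* K :* s)
                                                refl K (sum c) ⟩
    5 * K * sum c                     ≡⟨ *-distribˡ-sum (5 * K) c ⟩
    sum (map (5 * K *_) c)            ≤⟨ sum-≤-split E (map (5 * K *_) c) in-E small ⟩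
    ∣ E ∣ * (K * m) + K * suc m       ≤⟨ +-monoˡ-≤ (K * suc m) (*-monoˡ-≤ (K * m) ∣E∣≤4) ⟩
    4 * (K * m) + K * suc m           ≡⟨ solve 2 (λ K m → con 4 :* (K :* m) :+ K :* (con 1 :+ m)
                                                        := K :* (con 5 :* m :+ con 1)) refl K m ⟩
    K * (5 * m + 1)                   ∎
    where
    in-E : ∀ i → i ∈ E → 5 * K * c i ≤ K * m
    in-E i _ = subst (_≤ K * m) (solve 2 (λ K c → K :* (con 5 :* c) := con 5 :* K :* c) refl K (c i))
                     (*-monoʳ-≤ K (5c≤m i))

suc-^3≤ : ∀ a → suc a ^ 3 ≤ a ^ 3 + 3 * suc a ^ 2
suc-^3≤ a = ≤-trans (m≤m+n (suc a ^ 3) (3 * a + 2)) (≤-reflexive (solve 1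
  (λ a → (con 1 :+ a) :^ 3 :+ (con 3 :* a :+ con 2) := a :^ 3 :+ con 3 :* (con 1 :+ a) :^ 2) refl a))

-- Since (kR − 1)³ ≥ (kR)³ − 3(kR)², the hypothesis at R > 3 X k² forces M ≥ X k³.
≤-from-approximants : ∀ X M k →
  (∀ P R → suc P ≡ k * suc R → X * P ^ 3 ≤ M * suc R ^ 3) → X * k ^ 3 ≤ M
≤-from-approximants X M zero    _      = subst (_≤ M) (sym (*-zeroʳ X)) z≤n
≤-from-approximants X M k@(suc _) approx with X * k ^ 3 ≤? M
... | yes Xk³≤M = Xk³≤M
... | no  Xk³≰M = ⊥-elim (<-irrefl refl (*-cancelʳ-≤ R A (R ^ 2) {{m^n≢0 R 2}} R³≤AR²))
  where
  open ≤-Reasoning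
  A = 3 * X * k ^ 2
  R = suc A
  P = pred (k * R)
  kR≡sucP : k * R ≡ suc P
  kR≡sucP = sym (suc-pred (k * R))
  R³≤AR² : R ^ 3 ≤ A * R ^ 2
  R³≤AR² = +-cancelˡ-≤ (M * R ^ 3) (R ^ 3) (A * R ^ 2) (begin
    M * R ^ 3 + R ^ 3              ≡⟨ +-comm (M * R ^ 3) (R ^ 3) ⟩
    suc M * R ^ 3                  ≤⟨ *-monoˡ-≤ (R ^ 3) (≰⇒> Xk³≰M) ⟩
    X * k ^ 3 * R ^ 3              ≡⟨ solve 3 (λ X k R → X :* k :^ 3 :* R :^ 3 := X :* (k :* R) :^ 3)
                                             refl X k R ⟩
    X * (k * R) ^ 3                ≡⟨ cong (λ t → X * t ^ 3) kR≡sucP ⟩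
    X * suc P ^ 3                  ≤⟨ *-monoʳ-≤ X (suc-^3≤ P) ⟩
    X * (P ^ 3 + 3 * suc P ^ 2)    ≡⟨ cong (λ t → X * (P ^ 3 + 3 * t ^ 2)) (sym kR≡sucP) ⟩
    X * (P ^ 3 + 3 * (k * R) ^ 2)  ≡⟨ solve 4 (λ X k R P → X :* (P :^ 3 :+ con 3 :* (k :* R) :^ 2)
                                             := X :* P :^ 3 :+ con 3 :* X :* k :^ 2 :* R :^ 2)
                                             refl X k R P ⟩
    X * P ^ 3 + A * R ^ 2          ≤⟨ +-monoˡ-≤ (A * R ^ 2) (approx P A (sym kR≡sucP)) ⟩
    M * R ^ 3 + A * R ^ 2          ∎)

3375nk³≤m³ : ∀ n m k → 2 ^ k ≤ n ^ 3 → AtLeast45CubeRootLog n m → 3375 * n * k ^ 3 ≤ m ^ 3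
3375nk³≤m³ n m k 2ᵏ≤n³ m-large = ≤-from-approximants (3375 * n) (m ^ 3) k approximant
  where
  2ᴾ<n³ᴿ : ∀ P R → suc P ≡ k * R → 2 ^ P < n ^ (3 * R)
  2ᴾ<n³ᴿ P R sucP≡kR = begin-strict
    2 ^ P        <⟨ ^-monoʳ-< 2 (s≤s (s≤s z≤n)) (n<1+n P) ⟩
    2 ^ suc P    ≡⟨ cong (2 ^_) sucP≡kR ⟩
    2 ^ (k * R)  ≡⟨ sym (^-*-assoc 2 k R) ⟩
    (2 ^ k) ^ R  ≤⟨ ^-monoˡ-≤ R 2ᵏ≤n³ ⟩
    (n ^ 3) ^ R  ≡⟨ ^-*-assoc n 3 R ⟩
    n ^ (3 * R)  ∎
    where open ≤-Reasoning
  approximant : ∀ P R → suc P ≡ k * suc R → 3375 * n * P ^ 3 ≤ m ^ 3 * suc R ^ 3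
  approximant P R sucP≡kR = *-cancelˡ-≤ 27 (subst₂ _≤_
    (solve 2 (λ n P → con (45 ^ 3) :* n :* P :^ 3 := con 27 :* (con 3375 :* n :* P :^ 3)) refl n P)
    (solve 2 (λ M R → M :* (con 3 :* R) :^ 3 := con 27 :* (M :* R :^ 3)) refl (m ^ 3) (suc R))
    (m-large P (3 * suc R) (s≤s z≤n) (2ᴾ<n³ᴿ P (suc R) sucP≡kR)))

^-cancelʳ-≤ : ∀ n .{{_ : NonZero n}} {x y} → x ^ n ≤ y ^ n → x ≤ y
^-cancelʳ-≤ n xⁿ≤yⁿ = ≮⇒≥ (λ y<x → <⇒≱ (^-monoˡ-< n y<x) xⁿ≤yⁿ)

5ku≤m : ∀ n m k u → u ^ 3 ≤ 27 * n → 3375 * n * k ^ 3 ≤ m ^ 3 → 5 * k * u ≤ m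
5ku≤m n m k u u³≤27n 3375nk³≤m³ = ^-cancelʳ-≤ 3 (begin
  (5 * k * u) ^ 3          ≡⟨ solve 2 (λ k u → (con 5 :* k :* u) :^ 3 := con 125 :* k :^ 3 :* u :^ 3)
                                       refl k u ⟩
  125 * k ^ 3 * u ^ 3      ≤⟨ *-monoʳ-≤ (125 * k ^ 3) u³≤27n ⟩
  125 * k ^ 3 * (27 * n)   ≡⟨ solve 2 (λ k n → con 125 :* k :^ 3 :* (con 27 :* n) := con 3375 :* n :* k :^ 3)
                                       refl k n ⟩
  3375 * n * k ^ 3         ≤⟨ 3375nk³≤m³ ⟩
  m ^ 3                    ∎)
  where open ≤-Reasoning

cover⇒∣∣≤sum : ∀ {n k} {I : Subset n} (Us : Vector (Subset n) k) →
  (∀ {v} → v ∈ I → ∃ λ i → v ∈ Us i) → ∣ I ∣ ≤ sum (map ∣_∣ Us)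
cover⇒∣∣≤sum Us covered = ≤-trans
  (p⊆q⇒∣p∣≤∣q∣ (λ v∈I → let i , v∈Uᵢ = covered v∈I in ⊆⋃ᵥ Us i v∈Uᵢ))
  (∣⋃ᵥ∣≤sum Us)

module _ {n} (G : Graph n) where

  clone-class-with-fifth : ∀ {k} (I : Subset n) (Us : Vector (Subset n) k) →
    (∀ i → Clones G (Us i)) → (∀ v → v ∈ I ⇔ ∃ λ i → v ∈ Us i) →
    (E : Subset k) → ∣ E ∣ ≤ 4 → (∀ i → i ∉ E → 5 * k * ∣ Us i ∣ ≤ ∣ I ∣) →
    Σ (Subset n) λ S → S ⊆ I × Clones G S × ∣ I ∣ ≤ 5 * ∣ S ∣
  clone-class-with-fifth I Us clones I≡⋃Us E ∣E∣≤4 small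
    with ∣ I ∣ | cover⇒∣∣≤sum Us (Equivalence.to (I≡⋃Us _))
  ... | zero  | _ =
    ⊥ , (λ v∈⊥ → ⊥-elim (∉⊥ v∈⊥)) , (λ u _ u∈⊥ → ⊥-elim (∉⊥ u∈⊥)) , z≤n
  ... | suc m | I≤ΣUs with fifth-in-some-part (map ∣_∣ Us) E (s≤s z≤n) I≤ΣUs ∣E∣≤4 small
  ...   | i , large =
    Us i , (λ v∈Uᵢ → Equivalence.from (I≡⋃Us _) (i , v∈Uᵢ)) , clones i , large

mainTheorem7 : ∀ (n : ℕ) (G : Graph n) → Compressed G →
    ∀ (I : Subset n) → Independent G I → AtLeast45CubeRootLog n ∣ I ∣ →
    Σ (Subset n) λ S → (S ⊆ I) × Clones G S × (∣ I ∣ ≤ 5 * ∣ S ∣)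
mainTheorem7 n G (partition , _) I independent I-large =
  let k , 2ᵏ≤n³ , Us , clones , I≡⋃Us , E , ∣E∣≤4 , small = partition I independent
  in clone-class-with-fifth G I Us clones I≡⋃Us E ∣E∣≤4
       (λ i i∉E → 5ku≤m n ∣ I ∣ k (∣ Us i ∣) (small i i∉E)
                        (3375nk³≤m³ n ∣ I ∣ k 2ᵏ≤n³ I-large))
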